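{- Let $\Gamma=\langle \alpha_1,\ldots,\alpha_k\rangle\subset\mathbb N^d$ be an affine semigroup with minimal generators $\alpha_1,\ldots,\alpha_k$, let $\mathbb K$ be a field, and for $j\ge 0$ let $$I_j=\big\langle y^z-y^w : \gamma\in\Gamma,\ z,w\in \mathsf Z(\gamma),\ \big||w|-|z|\big|\le j\big\rangle\subset \mathbb K[y_1,\ldots,y_k].$$ Let $A$ be the $(d+1)\times(2k+1)$ integer matrix whose first $d$ rows are $(\alpha_{r1},\ldots,\alpha_{rk},-\alpha_{r1},\ldots,-\alpha_{rk},0)$ for $r=1,\ldots,d$ (where $\alpha_{ri}$ is the $r$-th coordinate of $\alpha_i$) and whose last row is $(1,\ldots,1,-1,\ldots,-1,-1)$; thus $x=(z,w,i)\in\mathbb N^k\times\mathbb N^k\times\mathbb N$ satisfies $Ax=0$ iff $\sum_l z_l\alpha_l=\sum_l w_l\alpha_l$ and $i=|z|-|w|$. Let $H$ be the Hilbert basis of $A$, i.e. the minimal generating set of the affine semigroup $\{x\in\mathbb N^{2k+1}: Ax=0\}$. Then for every $j\ge 0$, $$\langle y^z-y^w : (z,w,i)\in H,\ i\le j\rangle = I_j.$$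
   Context: An affine semigroup is a finitely generated submonoid of $\mathbb N^d$; it has a unique minimal generating set (its atoms) $\alpha_1,\ldots,\alpha_k$. A factorization of $\gamma\in\Gamma$ is a tuple $z\in\mathbb N^k$ with $z_1\alpha_1+\cdots+z_k\alpha_k=\gamma$; $\mathsf Z(\gamma)\subseteq\mathbb N^k$ is the set of factorizations of $\gamma$, and $|z|=z_1+\cdots+z_k$ is the length of $z$. For $z\in\mathbb N^k$, $y^z=y_1^{z_1}\cdots y_k^{z_k}$. -}

module Defs where

open import Level using (Level; _⊔_)
open import Data.Nat as ℕ using (ℕ; zero; suc)
open import Data.Integer as ℤ using (ℤ)
open import Data.Fin using (Fin)
open import Data.Vec using (Vec; []; _∷_; _++_; replicate; zipWith; foldr; map; lookup; tabulate)
open import Data.Vec.Properties using (≡-dec)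
open import Data.List as List using (List)
open import Data.List.Relation.Unary.All using (All)
open import Data.Product using (Σ; ∃; ∃-syntax; _×_; _,_)
open import Data.Sum using (_⊎_)
open import Relation.Nullary using (¬_; yes; no)
open import Relation.Binary.PropositionalEquality using (_≡_; _≢_)
open import Algebra.Bundles using (CommutativeRing)
open import Data.Nat.Properties using (_≟_)

_⊕_ : ∀ {n} → Vec ℕ n → Vec ℕ n → Vec ℕ n
_⊕_ = zipWith ℕ._+_

0ⁿ : ∀ {n} → Vec ℕ n
0ⁿ = replicate _ 0

_·_ : ∀ {n} → ℕ → Vec ℕ n → Vec ℕ n
c · v = map (c ℕ.*_) v

lincomb : ∀ {d k} → Vec (Vec ℕ d) k → Vec ℕ k → Vec ℕ d
lincomb []      []       = 0ⁿ
lincomb (a ∷ α) (z ∷ zs) = (z · a) ⊕ lincomb α zs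

len : ∀ {k} → Vec ℕ k → ℕ
len z = foldr _ ℕ._+_ 0 z

InSemigroup : ∀ {d k} → Vec (Vec ℕ d) k → Vec ℕ d → Set
InSemigroup α γ = ∃[ z ] lincomb α z ≡ γ

IsFactorization : ∀ {d k} → Vec (Vec ℕ d) k → Vec ℕ d → Vec ℕ k → Set
IsFactorization α γ z = lincomb α z ≡ γ

IsAtom : ∀ {n} → (Vec ℕ n → Set) → Vec ℕ n → Set
IsAtom M x = M x × x ≢ 0ⁿ
  × (∀ a b → M a → M b → x ≡ a ⊕ b → a ≡ 0ⁿ ⊎ b ≡ 0ⁿ)

MinimalGenerators : ∀ {d k} → Vec (Vec ℕ d) k → Set
MinimalGenerators {k = k} α =
  (∀ (i j : Fin k) → lookup α i ≡ lookup α j → i ≡ j)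
  × (∀ (i : Fin k) → IsAtom (InSemigroup α) (lookup α i))

Matrix : ℕ → ℕ → Set
Matrix m n = Vec (Vec ℤ n) m

mulVec : ∀ {m n} → Matrix m n → Vec ℕ n → Vec ℤ m
mulVec A x = map (λ row → foldr _ ℤ._+_ (ℤ.+ 0) (zipWith ℤ._*_ row (map ℤ.+_ x))) A

matA : ∀ {d k} → Vec (Vec ℕ d) k → Matrix (d ℕ.+ 1) (k ℕ.+ (k ℕ.+ 1))
matA {d} {k} α =
  tabulate (λ (r : Fin d) →
      map ℤ.+_ (map (λ a → lookup a r) α)
   ++ map (λ a → ℤ.- (ℤ.+ lookup a r)) α
   ++ (ℤ.+ 0) ∷ [])
  ++ (replicate k (ℤ.+ 1) ++ replicate k (ℤ.- (ℤ.+ 1)) ++ ℤ.- (ℤ.+ 1) ∷ []) ∷ []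

Kernel : ∀ {m n} → Matrix m n → Vec ℕ n → Set
Kernel A x = mulVec A x ≡ replicate _ (ℤ.+ 0)

-- x belongs to the Hilbert basis of A: an atom (= element of the minimal
-- generating set) of the affine semigroup {x ∈ ℕⁿ : A x = 0}
HilbertBasis : ∀ {m n} → Matrix m n → Vec ℕ n → Set
HilbertBasis A = IsAtom (Kernel A)

IsField : ∀ {c ℓ} → CommutativeRing c ℓ → Set (c ⊔ ℓ)
IsField K = ¬ (1# ≈ 0#) × (∀ x → ¬ (x ≈ 0#) → ∃[ y ] (x * y ≈ 1#))
  where open CommutativeRing K

module Poly {c ℓ} (K : CommutativeRing c ℓ) (k : ℕ) where
  open CommutativeRing K

  -- a polynomial is a finite formal sum of terms c·y^m  (m ∈ ℕᵏ)
  Polynomial : Set c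
  Polynomial = List (Carrier × Vec ℕ k)

  coeff : Polynomial → Vec ℕ k → Carrier
  coeff List.[] m = 0#
  coeff ((a , m′) List.∷ p) m with ≡-dec _≟_ m′ m
  ... | yes _ = a + coeff p m
  ... | no  _ = coeff p m

  _≈ₚ_ : Polynomial → Polynomial → Set ℓ
  p ≈ₚ q = ∀ m → coeff p m ≈ coeff q m

  termMul : Carrier → Vec ℕ k → Polynomial → Polynomial
  termMul a m p = List.map (λ { (b , m′) → (a * b , m ⊕ m′) }) p

  binom : Vec ℕ k → Vec ℕ k → Polynomial
  binom z w = (1# , z) List.∷ (- 1# , w) List.∷ List.[]

  InIdeal : (Polynomial → Set c) → Polynomial → Set (c ⊔ ℓ)
  InIdeal G p =
    Σ (List (Carrier × Vec ℕ k × Polynomial)) λ L → All (λ { (a , m , g) → G g }) L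
      × p ≈ₚ List.concatMap (λ { (a , m , g) → termMul a m g }) L

  SameIdeal : (Polynomial → Set c) → (Polynomial → Set c) → Set (c ⊔ ℓ)
  SameIdeal G G′ = ∀ p → (InIdeal G p → InIdeal G′ p) × (InIdeal G′ p → InIdeal G p)

module _ {c ℓ} (K : CommutativeRing c ℓ) {d k : ℕ} (α : Vec (Vec ℕ d) k) where
  open Poly K k

  HilbertGens : ℕ → Polynomial → Set c
  HilbertGens j g = ∃[ z ] ∃[ w ] ∃[ i ]
    (HilbertBasis (matA α) (z ++ w ++ i ∷ []) × i ℕ.≤ j × g ≡ binom z w)

  FactorizationGens : ℕ → Polynomial → Set c
  FactorizationGens j g = ∃[ γ ] ∃[ z ] ∃[ w ]
    (InSemigroup α γ × IsFactorization α γ z × IsFactorization α γ w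
     × ℕ.∣ len w - len z ∣ ℕ.≤ j × g ≡ binom z w)

module Submission where

-- A triple (z,w,i) lies in ker A ∩ ℕ^{2k+1} iff z,w factor the same element
-- and |z| = |w| + i.  Hence a Hilbert-basis binomial with i ≤ j is one of the
-- generators of I_j.  Conversely, for a generator y^z - y^w of I_j we may
-- assume |w| ≤ |z| (otherwise negate); then (z,w,|z|-|w|) is in the kernel,
-- hence a sum of atoms (z₁,w₁,i₁) + ⋯ + (z_r,w_r,i_r) with every iᵤ ≤ j, and
-- the telescoping identity
--   y^m (y^{z₁+z'} - y^{w₁+w'}) = y^{m+z'} (y^{z₁} - y^{w₁}) + y^{m+w₁} (y^{z'} - y^{w'})
-- writes each term multiple of y^z - y^w via Hilbert-basis binomials.

open import Defs
open import Data.Nat as ℕ using (ℕ; zero; suc; _≤_; _<_)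
import Data.Nat.Properties as ℕP
open import Data.Nat.Induction using (<-wellFounded)
import Data.Integer.Properties as ℤP
open import Data.Fin using (Fin)
open import Data.Vec as Vec using (Vec; []; _∷_; replicate; lookup; tabulate)
import Data.Vec.Properties as VecP
open import Data.Vec.Relation.Binary.Pointwise.Inductive
  using (Pointwise-≡⇒≡; zipWith-assoc; zipWith-comm; zipWith-identityˡ)
open import Data.List as List using (List; concatMap)
import Data.List.Properties as ListP
open import Data.List.Relation.Unary.All as All using (All)
import Data.List.Relation.Unary.All.Properties as AllP
open import Data.Product using (∃-syntax; _×_; _,_; proj₁; proj₂)
open import Data.Sum using (_⊎_; inj₁; inj₂)
open import Data.Empty using (⊥-elim)
open import Function using (_on_)
open import Induction.WellFounded using (Acc; acc)
import Relation.Binary.Construct.On as On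
open import Relation.Nullary using (Dec; yes; no)
open import Relation.Nullary.Decidable using (map′; _⊎-dec_; _×-dec_; ¬?)
open import Relation.Binary.PropositionalEquality
  using (_≡_; _≢_; refl; sym; trans; cong; cong₂; subst; module ≡-Reasoning)
open import Algebra.Bundles using (CommutativeRing)
import Algebra.Properties.CommutativeSemigroup as CommSemigroupProperties

⊕-assoc : ∀ {n} (a b c : Vec ℕ n) → (a ⊕ b) ⊕ c ≡ a ⊕ (b ⊕ c)
⊕-assoc a b c = Pointwise-≡⇒≡ (zipWith-assoc ℕP.+-assoc a b c)

⊕-comm : ∀ {n} (a b : Vec ℕ n) → a ⊕ b ≡ b ⊕ a
⊕-comm a b = Pointwise-≡⇒≡ (zipWith-comm ℕP.+-comm a b)

⊕-identityˡ : ∀ {n} (a : Vec ℕ n) → 0ⁿ ⊕ a ≡ a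
⊕-identityˡ a = Pointwise-≡⇒≡ (zipWith-identityˡ ℕP.+-identityˡ a)

⊕-identityʳ : ∀ {n} (a : Vec ℕ n) → a ⊕ 0ⁿ ≡ a
⊕-identityʳ a = trans (⊕-comm a 0ⁿ) (⊕-identityˡ a)

len-⊕ : ∀ {n} (a b : Vec ℕ n) → len (a ⊕ b) ≡ len a ℕ.+ len b
len-⊕ []      []      = refl
len-⊕ (x ∷ a) (y ∷ b) =
  trans (cong (x ℕ.+ y ℕ.+_) (len-⊕ a b)) (interchange x y (len a) (len b))
  where open CommSemigroupProperties ℕP.+-commutativeSemigroup using (interchange)

len≡0⇒0ⁿ : ∀ {n} (a : Vec ℕ n) → len a ≡ 0 → a ≡ 0ⁿ
len≡0⇒0ⁿ []           _  = refl
len≡0⇒0ⁿ (zero ∷ a)   ≡0 = cong (0 ∷_) (len≡0⇒0ⁿ a ≡0)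
len≡0⇒0ⁿ (suc x ∷ a)  ()

len-<-⊕ : ∀ {n} (a b : Vec ℕ n) → b ≢ 0ⁿ → len a < len (a ⊕ b)
len-<-⊕ a b b≢0 = subst (len a <_) (sym (len-⊕ a b)) (ℕP.m<m+n (len a) 0<len-b)
  where
  0<len-b : 0 < len b
  0<len-b with len b in eq
  ... | zero  = ⊥-elim (b≢0 (len≡0⇒0ⁿ b eq))
  ... | suc _ = ℕ.s≤s ℕ.z≤n

sumᵥ : ∀ {n} → List (Vec ℕ n) → Vec ℕ n
sumᵥ = List.foldr _⊕_ 0ⁿ

sumᵥ-++ : ∀ {n} (xs ys : List (Vec ℕ n)) → sumᵥ (xs List.++ ys) ≡ sumᵥ xs ⊕ sumᵥ ys
sumᵥ-++ List.[]       ys = sym (⊕-identityˡ (sumᵥ ys))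
sumᵥ-++ (x List.∷ xs) ys = trans (cong (x ⊕_) (sumᵥ-++ xs ys)) (sym (⊕-assoc x _ _))

-- Only finitely many splittings c = p + q exist, so searching them is decidable.
split-ℕ? : (Q : ℕ → ℕ → Set) → (∀ p q → Dec (Q p q)) →
           ∀ c → Dec (∃[ p ] ∃[ q ] (p ℕ.+ q ≡ c × Q p q))
split-ℕ? Q Q? zero =
  map′ (λ h → 0 , 0 , refl , h) (λ { (zero , zero , refl , h) → h }) (Q? 0 0)
split-ℕ? Q Q? (suc c) =
  map′ join part (Q? 0 (suc c) ⊎-dec split-ℕ? (λ p → Q (suc p)) (λ p → Q? (suc p)) c)
  where
  Smaller : Set
  Smaller = Q 0 (suc c) ⊎ ∃[ p ] ∃[ q ] (p ℕ.+ q ≡ c × Q (suc p) q)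
  join : Smaller → ∃[ p ] ∃[ q ] (p ℕ.+ q ≡ suc c × Q p q)
  join (inj₁ h)                = 0 , suc c , refl , h
  join (inj₂ (p , q , e , h)) = suc p , q , cong suc e , h
  part : ∃[ p ] ∃[ q ] (p ℕ.+ q ≡ suc c × Q p q) → Smaller
  part (zero  , q , refl , h) = inj₁ h
  part (suc p , q , e    , h) = inj₂ (p , q , ℕP.suc-injective e , h)

split? : ∀ {n} (Q : Vec ℕ n → Vec ℕ n → Set) → (∀ a b → Dec (Q a b)) →
         ∀ x → Dec (∃[ a ] ∃[ b ] (a ⊕ b ≡ x × Q a b))
split? Q Q? [] = map′ (λ h → [] , [] , refl , h) (λ { ([] , [] , _ , h) → h }) (Q? [] [])
split? {suc n} Q Q? (c ∷ x) = map′ join part (split-ℕ? Qc Qc? c)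
  where
  Qc : ℕ → ℕ → Set
  Qc p q = ∃[ a ] ∃[ b ] (a ⊕ b ≡ x × Q (p ∷ a) (q ∷ b))
  Qc? : ∀ p q → Dec (Qc p q)
  Qc? p q = split? (λ a b → Q (p ∷ a) (q ∷ b)) (λ a b → Q? (p ∷ a) (q ∷ b)) x
  join : ∃[ p ] ∃[ q ] (p ℕ.+ q ≡ c × Qc p q) → ∃[ a ] ∃[ b ] (a ⊕ b ≡ c ∷ x × Q a b)
  join (p , q , e , a , b , e′ , h) = p ∷ a , q ∷ b , cong₂ _∷_ e e′ , h
  part : ∃[ a ] ∃[ b ] (a ⊕ b ≡ c ∷ x × Q a b) → ∃[ p ] ∃[ q ] (p ℕ.+ q ≡ c × Qc p q)
  part (p ∷ a , q ∷ b , e , h) =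
    p , q , VecP.∷-injectiveˡ e , a , b , VecP.∷-injectiveʳ e , h

-- Every element of a decidable subset M ⊆ ℕⁿ is a finite sum of atoms of M:
-- split off nonzero summands in M until none is left (length decreases).
module AtomicDecomposition {n : ℕ} (M : Vec ℕ n → Set) (M? : ∀ x → Dec (M x)) where

  AtomicSum : Vec ℕ n → Set
  AtomicSum x = ∃[ xs ] (All (IsAtom M) xs × x ≡ sumᵥ xs)

  ProperSplit : Vec ℕ n → Vec ℕ n → Set
  ProperSplit a b = M a × M b × a ≢ 0ⁿ × b ≢ 0ⁿ

  properSplit? : ∀ a b → Dec (ProperSplit a b)
  properSplit? a b = M? a ×-dec M? b ×-dec ¬? (≟0 a) ×-dec ¬? (≟0 b)
    where
    ≟0 : ∀ v → Dec (v ≡ 0ⁿ)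
    ≟0 v = VecP.≡-dec ℕP._≟_ v 0ⁿ

  decompose-acc : ∀ x → Acc (_<_ on len) x → M x → AtomicSum x
  decompose-acc x (acc shorter) x∈M with VecP.≡-dec ℕP._≟_ x 0ⁿ
  ... | yes x≡0 = List.[] , All.[] , x≡0
  ... | no  x≢0 with split? ProperSplit properSplit? x
  ...   | yes (a , b , refl , a∈M , b∈M , a≢0 , b≢0) =
    let (as , atoms-a , a≡) = decompose-acc a (shorter (len-<-⊕ a b b≢0)) a∈M
        (bs , atoms-b , b≡) = decompose-acc b
                                (shorter (subst (len b <_) (cong len (⊕-comm b a)) (len-<-⊕ b a a≢0)))
                                b∈M
    in as List.++ bs , AllP.++⁺ atoms-a atoms-b
     , trans (cong₂ _⊕_ a≡ b≡) (sym (sumᵥ-++ as bs))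
  ...   | no  no-split = x List.∷ List.[] , (x∈M , x≢0 , atom) All.∷ All.[] , sym (⊕-identityʳ x)
    where
    atom : ∀ a b → M a → M b → x ≡ a ⊕ b → a ≡ 0ⁿ ⊎ b ≡ 0ⁿ
    atom a b a∈M b∈M x≡ with VecP.≡-dec ℕP._≟_ a 0ⁿ | VecP.≡-dec ℕP._≟_ b 0ⁿ
    ... | yes a≡0 | _       = inj₁ a≡0
    ... | no  _   | yes b≡0 = inj₂ b≡0
    ... | no  a≢0 | no  b≢0 = ⊥-elim (no-split (a , b , sym x≡ , a∈M , b∈M , a≢0 , b≢0))

  decompose : ∀ x → M x → AtomicSum x
  decompose x = decompose-acc x (On.wellFounded len <-wellFounded x)

lookup-ext : ∀ {A : Set} {n} {u v : Vec A n} → (∀ r → lookup u r ≡ lookup v r) → u ≡ v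
lookup-ext {u = u} {v} h =
  trans (sym (VecP.tabulate∘lookup u)) (trans (VecP.tabulate-cong h) (VecP.tabulate∘lookup v))

tabulate-const : ∀ {A : Set} {n} {f : Fin n → A} {x : A} → (∀ r → f r ≡ x) → tabulate f ≡ replicate n x
tabulate-const {f = f} {x} h =
  lookup-ext (λ r → trans (VecP.lookup∘tabulate f r) (trans (h r) (sym (VecP.lookup-replicate r x))))

replicate-++ : ∀ {A : Set} m n (x : A) → replicate (m ℕ.+ n) x ≡ replicate m x Vec.++ replicate n x
replicate-++ zero    n x = refl
replicate-++ (suc m) n x = cong (x ∷_) (replicate-++ m n x)

triple : ∀ {k} → Vec ℕ k → Vec ℕ k → ℕ → Vec ℕ (k ℕ.+ (k ℕ.+ 1))
triple z w i = z Vec.++ w Vec.++ i ∷ []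

triple-surjective : ∀ {k} (x : Vec ℕ (k ℕ.+ (k ℕ.+ 1))) → ∃[ z ] ∃[ w ] ∃[ i ] (x ≡ triple z w i)
triple-surjective {k} x with Vec.splitAt k x
... | z , rest , refl with Vec.splitAt k rest
...   | w , i ∷ [] , refl = z , w , i , refl

triple-injective : ∀ {k} (z z′ w w′ : Vec ℕ k) {i i′} →
                   triple z w i ≡ triple z′ w′ i′ → z ≡ z′ × w ≡ w′ × i ≡ i′
triple-injective z z′ w w′ {i} {i′} e =
  VecP.++-injectiveˡ z z′ e , VecP.++-injectiveˡ w w′ rest , VecP.∷-injectiveˡ (VecP.++-injectiveʳ w w′ rest)
  where
  rest : w Vec.++ i ∷ [] ≡ w′ Vec.++ i′ ∷ []
  rest = VecP.++-injectiveʳ z z′ e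

triple-⊕ : ∀ {k} (z z′ w w′ : Vec ℕ k) i i′ →
           triple z w i ⊕ triple z′ w′ i′ ≡ triple (z ⊕ z′) (w ⊕ w′) (i ℕ.+ i′)
triple-⊕ z z′ w w′ i i′ =
  trans (VecP.zipWith-++ ℕ._+_ z _ z′ _) (cong ((z ⊕ z′) Vec.++_) (VecP.zipWith-++ ℕ._+_ w _ w′ _))

triple-0 : ∀ {k} → 0ⁿ ≡ triple {k} 0ⁿ 0ⁿ 0
triple-0 {k} = trans (replicate-++ k (k ℕ.+ 1) 0) (cong (replicate k 0 Vec.++_) (replicate-++ k 1 0))

module KernelOfA where
  open import Data.Integer using (ℤ; +_; -_; _+_; _-_; _*_)

  dot : ∀ {n} → Vec ℤ n → Vec ℕ n → ℤ
  dot row x = Vec.foldr _ _+_ (+ 0) (Vec.zipWith _*_ row (Vec.map +_ x))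

  dot-++ : ∀ {m n} (u : Vec ℤ m) (v : Vec ℤ n) x y → dot (u Vec.++ v) (x Vec.++ y) ≡ dot u x + dot v y
  dot-++ []      v []      y = sym (ℤP.+-identityˡ (dot v y))
  dot-++ (r ∷ u) v (a ∷ x) y =
    trans (cong (_+_ (r * + a)) (dot-++ u v x y)) (sym (ℤP.+-assoc (r * + a) _ _))

  dot-neg : ∀ {n} (u : Vec ℤ n) x → dot (Vec.map -_ u) x ≡ - dot u x
  dot-neg []      []      = refl
  dot-neg (r ∷ u) (a ∷ x) = begin
    - r * + a + dot (Vec.map -_ u) x   ≡⟨ cong₂ _+_ (sym (ℤP.neg-distribˡ-* r (+ a))) (dot-neg u x) ⟩
    - (r * + a) + - dot u x            ≡⟨ sym (ℤP.neg-distrib-+ (r * + a) _) ⟩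
    - (r * + a + dot u x)              ∎
    where open ≡-Reasoning

  dot-coordinate : ∀ {d k} (α : Vec (Vec ℕ d) k) z (r : Fin d) →
    dot (Vec.map +_ (Vec.map (λ a → lookup a r) α)) z ≡ + lookup (lincomb α z) r
  dot-coordinate []      []       r = cong +_ (sym (VecP.lookup-replicate r 0))
  dot-coordinate (a ∷ α) (x ∷ z)  r = begin
    dot (Vec.map +_ (Vec.map (λ b → lookup b r) (a ∷ α))) (x ∷ z)
                                                           ≡⟨ cong₂ _+_ (sym (ℤP.pos-* (lookup a r) x)) (dot-coordinate α z r) ⟩
    + (lookup a r ℕ.* x) + + lookup (lincomb α z) r      ≡⟨ sym (ℤP.pos-+ (lookup a r ℕ.* x) (lookup (lincomb α z) r)) ⟩
    + (lookup a r ℕ.* x ℕ.+ lookup (lincomb α z) r)        ≡⟨ cong +_ (cong₂ ℕ._+_ (ℕP.*-comm (lookup a r) x) refl) ⟩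
    + (x ℕ.* lookup a r ℕ.+ lookup (lincomb α z) r)        ≡⟨ cong +_ (cong₂ ℕ._+_ (sym (VecP.lookup-map r (x ℕ.*_) a)) refl) ⟩
    + (lookup (x · a) r ℕ.+ lookup (lincomb α z) r)        ≡⟨ cong +_ (sym (VecP.lookup-zipWith ℕ._+_ r (x · a) (lincomb α z))) ⟩
    + lookup (lincomb (a ∷ α) (x ∷ z)) r                   ∎
    where open ≡-Reasoning

  dot-coordinate⁻ : ∀ {d k} (α : Vec (Vec ℕ d) k) z (r : Fin d) →
    dot (Vec.map (λ a → - (+ lookup a r)) α) z ≡ - + lookup (lincomb α z) r
  dot-coordinate⁻ α z r = begin
    dot (Vec.map (λ a → - (+ lookup a r)) α) z                 ≡⟨ cong (λ u → dot u z) (VecP.map-∘ -_ (λ a → + lookup a r) α) ⟩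
    dot (Vec.map -_ (Vec.map (λ a → + lookup a r) α)) z        ≡⟨ dot-neg (Vec.map (λ a → + lookup a r) α) z ⟩
    - dot (Vec.map (λ a → + lookup a r) α) z                   ≡⟨ cong (λ u → - dot u z) (VecP.map-∘ +_ (λ a → lookup a r) α) ⟩
    - dot (Vec.map +_ (Vec.map (λ a → lookup a r) α)) z        ≡⟨ cong -_ (dot-coordinate α z r) ⟩
    - + lookup (lincomb α z) r                                 ∎
    where open ≡-Reasoning

  dot-ones : ∀ {k} (z : Vec ℕ k) → dot (replicate k (+ 1)) z ≡ + len z
  dot-ones []      = refl
  dot-ones (x ∷ z) = trans (cong₂ _+_ (ℤP.*-identityˡ (+ x)) (dot-ones z)) (sym (ℤP.pos-+ x (len z)))

  dot-minus-ones : ∀ {k} (z : Vec ℕ k) → dot (replicate k (- + 1)) z ≡ - + len z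
  dot-minus-ones {k} z = begin
    dot (replicate k (- + 1)) z          ≡⟨ cong (λ u → dot u z) (sym (VecP.map-replicate -_ (+ 1) k)) ⟩
    dot (Vec.map -_ (replicate k (+ 1))) z ≡⟨ dot-neg (replicate k (+ 1)) z ⟩
    - dot (replicate k (+ 1)) z          ≡⟨ cong -_ (dot-ones z) ⟩
    - + len z                            ∎
    where open ≡-Reasoning

  module _ {d k : ℕ} (α : Vec (Vec ℕ d) k) where

    coordinateRow : Fin d → Vec ℤ (k ℕ.+ (k ℕ.+ 1))
    coordinateRow r =
         Vec.map +_ (Vec.map (λ a → lookup a r) α)
      Vec.++ Vec.map (λ a → - (+ lookup a r)) α
      Vec.++ + 0 ∷ []

    lengthRow : Vec ℤ (k ℕ.+ (k ℕ.+ 1))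
    lengthRow = replicate k (+ 1) Vec.++ replicate k (- + 1) Vec.++ - + 1 ∷ []

    coordinateRow-value : ∀ z w i r →
      dot (coordinateRow r) (triple z w i) ≡ + lookup (lincomb α z) r - + lookup (lincomb α w) r
    coordinateRow-value z w i r = begin
      dot (coordinateRow r) (triple z w i)
        ≡⟨ dot-++ (Vec.map +_ (Vec.map (λ a → lookup a r) α)) _ z _ ⟩
      dot positive z + dot (negative Vec.++ + 0 ∷ []) (w Vec.++ i ∷ [])
        ≡⟨ cong (_+_ (dot positive z)) (dot-++ negative _ w _) ⟩
      dot positive z + (dot negative w + + 0)
        ≡⟨ cong₂ _+_ (dot-coordinate α z r) (trans (ℤP.+-identityʳ _) (dot-coordinate⁻ α w r)) ⟩
      + lookup (lincomb α z) r - + lookup (lincomb α w) r ∎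
      where
      open ≡-Reasoning
      positive negative : Vec ℤ k
      positive = Vec.map +_ (Vec.map (λ a → lookup a r) α)
      negative = Vec.map (λ a → - (+ lookup a r)) α

    lengthRow-value : ∀ z w i → dot lengthRow (triple z w i) ≡ + len z - + (len w ℕ.+ i)
    lengthRow-value z w i = begin
      dot lengthRow (triple z w i)
        ≡⟨ dot-++ (replicate k (+ 1)) _ z _ ⟩
      dot (replicate k (+ 1)) z + dot (replicate k (- + 1) Vec.++ - + 1 ∷ []) (w Vec.++ i ∷ [])
        ≡⟨ cong (_+_ (dot (replicate k (+ 1)) z)) (dot-++ (replicate k (- + 1)) _ w _) ⟩
      dot (replicate k (+ 1)) z + (dot (replicate k (- + 1)) w + (- + 1 * + i + + 0))
        ≡⟨ cong₂ _+_ (dot-ones z) (cong₂ _+_ (dot-minus-ones w) (trans (ℤP.+-identityʳ _) (ℤP.-1*i≡-i (+ i)))) ⟩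
      + len z + (- + len w + - + i)
        ≡⟨ cong (_+_ (+ len z)) (sym (ℤP.neg-distrib-+ (+ len w) (+ i))) ⟩
      + len z - (+ len w + + i)
        ≡⟨ cong (λ t → + len z - t) (sym (ℤP.pos-+ (len w) i)) ⟩
      + len z - + (len w ℕ.+ i) ∎
      where open ≡-Reasoning

    matA-triple : ∀ z w i → mulVec (matA α) (triple z w i) ≡
      tabulate (λ r → + lookup (lincomb α z) r - + lookup (lincomb α w) r)
        Vec.++ (+ len z - + (len w ℕ.+ i)) ∷ []
    matA-triple z w i = trans (VecP.map-++ (λ row → dot row x) (tabulate coordinateRow) (lengthRow ∷ []))
      (cong₂ Vec._++_
        (trans (sym (VecP.tabulate-∘ (λ row → dot row x) coordinateRow)) (VecP.tabulate-cong (coordinateRow-value z w i)))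
        (cong (_∷ []) (lengthRow-value z w i)))
      where
      x : Vec ℕ (k ℕ.+ (k ℕ.+ 1))
      x = triple z w i

    zeroℤ : replicate (d ℕ.+ 1) (+ 0) ≡ replicate d (+ 0) Vec.++ + 0 ∷ []
    zeroℤ = replicate-++ d 1 (+ 0)

    kernel⇒ : ∀ {z w i} → Kernel (matA α) (triple z w i) → lincomb α z ≡ lincomb α w × len z ≡ len w ℕ.+ i
    kernel⇒ {z} {w} {i} inKer = lookup-ext same-coordinate , same-length
      where
      difference : Fin d → ℤ
      difference r = + lookup (lincomb α z) r - + lookup (lincomb α w) r
      e : tabulate difference Vec.++ (+ len z - + (len w ℕ.+ i)) ∷ [] ≡ replicate d (+ 0) Vec.++ + 0 ∷ []
      e = trans (sym (matA-triple z w i)) (trans inKer zeroℤ)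
      same-coordinate : ∀ r → lookup (lincomb α z) r ≡ lookup (lincomb α w) r
      same-coordinate r = ℤP.+-injective (ℤP.i-j≡0⇒i≡j _ _ (begin
        difference r                  ≡⟨ sym (VecP.lookup∘tabulate difference r) ⟩
        lookup (tabulate difference) r
          ≡⟨ cong (λ v → lookup v r) (VecP.++-injectiveˡ (tabulate difference) (replicate d (+ 0)) e) ⟩
        lookup (replicate d (+ 0)) r ≡⟨ VecP.lookup-replicate r (+ 0) ⟩
        + 0 ∎))
        where open ≡-Reasoning
      same-length : len z ≡ len w ℕ.+ i
      same-length = ℤP.+-injective (ℤP.i-j≡0⇒i≡j _ _
        (VecP.∷-injectiveˡ (VecP.++-injectiveʳ (tabulate difference) (replicate d (+ 0)) e)))

    kernel⇐ : ∀ {z w i} → lincomb α z ≡ lincomb α w → len z ≡ len w ℕ.+ i → Kernel (matA α) (triple z w i)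
    kernel⇐ {z} {w} {i} same-element same-length = begin
      mulVec (matA α) (triple z w i) ≡⟨ matA-triple z w i ⟩
      tabulate _ Vec.++ _ ∷ []       ≡⟨ cong₂ Vec._++_ coordinates-vanish (cong (_∷ []) length-vanishes) ⟩
      replicate d (+ 0) Vec.++ + 0 ∷ [] ≡⟨ sym zeroℤ ⟩
      replicate (d ℕ.+ 1) (+ 0)     ∎
      where
      open ≡-Reasoning
      coordinates-vanish : tabulate (λ r → + lookup (lincomb α z) r - + lookup (lincomb α w) r) ≡ replicate d (+ 0)
      coordinates-vanish = tabulate-const (λ r → ℤP.i≡j⇒i-j≡0 (cong (λ v → + lookup v r) same-element))
      length-vanishes : + len z - + (len w ℕ.+ i) ≡ + 0
      length-vanishes = ℤP.i≡j⇒i-j≡0 (cong +_ same-length)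

open KernelOfA using (kernel⇒; kernel⇐)

module BinomialIdeals {c ℓ} (K : CommutativeRing c ℓ) (k : ℕ) where
  open CommutativeRing K renaming (refl to ≈-refl; sym to ≈-sym; trans to ≈-trans)
  open Poly K k
  open import Algebra.Properties.Ring ring using (-‿involutive; -‿distribˡ-*; -‿distribʳ-*)
  open CommSemigroupProperties +-commutativeSemigroup using (x∙yz≈y∙xz)
  open import Relation.Binary.Reasoning.Setoid setoid

  coeff-++ : ∀ p q m → coeff (p List.++ q) m ≈ coeff p m + coeff q m
  coeff-++ List.[]              q m = ≈-sym (+-identityˡ (coeff q m))
  coeff-++ ((a , m′) List.∷ p) q m with VecP.≡-dec ℕP._≟_ m′ m
  ... | yes _ = ≈-trans (+-congˡ (coeff-++ p q m)) (≈-sym (+-assoc a _ _))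
  ... | no  _ = coeff-++ p q m

  coeff-∷-cong : ∀ e p q m → coeff p m ≈ coeff q m → coeff (e List.∷ p) m ≈ coeff (e List.∷ q) m
  coeff-∷-cong (a , m′) p q m p≈q with VecP.≡-dec ℕP._≟_ m′ m
  ... | yes _ = +-congˡ p≈q
  ... | no  _ = p≈q

  coeff-head-cong : ∀ {a b} m′ p m → a ≈ b → coeff ((a , m′) List.∷ p) m ≈ coeff ((b , m′) List.∷ p) m
  coeff-head-cong m′ p m a≈b with VecP.≡-dec ℕP._≟_ m′ m
  ... | yes _ = +-congʳ a≈b
  ... | no  _ = ≈-refl

  coeff-swap : ∀ e₁ e₂ p m → coeff (e₁ List.∷ e₂ List.∷ p) m ≈ coeff (e₂ List.∷ e₁ List.∷ p) m
  coeff-swap e₁ e₂ p m = begin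
    coeff (e₁ List.∷ e₂ List.∷ p) m                  ≈⟨ coeff-++ (e₁ List.∷ List.[]) (e₂ List.∷ p) m ⟩
    c₁ + coeff (e₂ List.∷ p) m                       ≈⟨ +-congˡ (coeff-++ (e₂ List.∷ List.[]) p m) ⟩
    c₁ + (c₂ + coeff p m)                            ≈⟨ x∙yz≈y∙xz c₁ c₂ (coeff p m) ⟩
    c₂ + (c₁ + coeff p m)                            ≈⟨ +-congˡ (≈-sym (coeff-++ (e₁ List.∷ List.[]) p m)) ⟩
    c₂ + coeff (e₁ List.∷ p) m                       ≈⟨ ≈-sym (coeff-++ (e₂ List.∷ List.[]) (e₁ List.∷ p) m) ⟩
    coeff (e₂ List.∷ e₁ List.∷ p) m                  ∎
    where
    c₁ c₂ : Carrier
    c₁ = coeff (e₁ List.∷ List.[]) m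
    c₂ = coeff (e₂ List.∷ List.[]) m

  coeff-match : ∀ a {m′} p {m} → m′ ≡ m → coeff ((a , m′) List.∷ p) m ≈ a + coeff p m
  coeff-match a {m′} p {m} m′≡m with VecP.≡-dec ℕP._≟_ m′ m
  ... | yes _     = ≈-refl
  ... | no  m′≢m = ⊥-elim (m′≢m m′≡m)

  coeff-mismatch : ∀ a {m′} p {m} → m′ ≢ m → coeff ((a , m′) List.∷ p) m ≈ coeff p m
  coeff-mismatch a {m′} p {m} m′≢m with VecP.≡-dec ℕP._≟_ m′ m
  ... | yes m′≡m = ⊥-elim (m′≢m m′≡m)
  ... | no  _     = ≈-refl

  coeff-cancel : ∀ a b m′ p m → a + b ≈ 0# →
                 coeff ((a , m′) List.∷ (b , m′) List.∷ p) m ≈ coeff p m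
  coeff-cancel a b m′ p m a+b≈0 with VecP.≡-dec ℕP._≟_ m′ m
  ... | yes m′≡m = begin
    a + coeff ((b , m′) List.∷ p) m ≈⟨ +-congˡ (coeff-match b p m′≡m) ⟩
    a + (b + coeff p m)              ≈⟨ ≈-sym (+-assoc a b _) ⟩
    (a + b) + coeff p m              ≈⟨ +-congʳ a+b≈0 ⟩
    0# + coeff p m                   ≈⟨ +-identityˡ _ ⟩
    coeff p m                        ∎
  ... | no  m′≢m = coeff-mismatch b p m′≢m

  opposite : ∀ a → a * 1# + a * - 1# ≈ 0#
  opposite a = begin
    a * 1# + a * - 1# ≈⟨ ≈-sym (distribˡ a 1# (- 1#)) ⟩
    a * (1# + - 1#)   ≈⟨ *-congˡ (-‿inverseʳ 1#) ⟩
    a * 0#            ≈⟨ zeroʳ a ⟩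
    0#                ∎

  binom-diagonal : ∀ a m z → termMul a m (binom z z) ≈ₚ List.[]
  binom-diagonal a m z n = coeff-cancel (a * 1#) (a * - 1#) (m ⊕ z) List.[] n (opposite a)

  binom-antisym : ∀ a m z w → termMul a m (binom z w) ≈ₚ termMul (- a) m (binom w z)
  binom-antisym a m z w n = begin
    coeff ((a * 1# , m ⊕ z) List.∷ (a * - 1# , m ⊕ w) List.∷ List.[]) n
      ≈⟨ coeff-swap (a * 1# , m ⊕ z) (a * - 1# , m ⊕ w) List.[] n ⟩
    coeff ((a * - 1# , m ⊕ w) List.∷ (a * 1# , m ⊕ z) List.∷ List.[]) n
      ≈⟨ coeff-head-cong (m ⊕ w) _ n (≈-trans (≈-sym (-‿distribʳ-* a 1#)) (-‿distribˡ-* a 1#)) ⟩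
    coeff ((- a * 1# , m ⊕ w) List.∷ (a * 1# , m ⊕ z) List.∷ List.[]) n
      ≈⟨ coeff-∷-cong (- a * 1# , m ⊕ w) _ _ n (coeff-head-cong (m ⊕ z) List.[] n a≈--a) ⟩
    coeff ((- a * 1# , m ⊕ w) List.∷ (- a * - 1# , m ⊕ z) List.∷ List.[]) n ∎
    where
    a≈--a : a * 1# ≈ - a * - 1#
    a≈--a = begin
      a * 1#         ≈⟨ ≈-sym (-‿involutive _) ⟩
      - (- (a * 1#)) ≈⟨ -‿cong (-‿distribʳ-* a 1#) ⟩
      - (a * - 1#)   ≈⟨ -‿distribˡ-* a (- 1#) ⟩
      - a * - 1#     ∎

  binom-telescope : ∀ a m z₁ z′ w₁ w′ →
    termMul a m (binom (z₁ ⊕ z′) (w₁ ⊕ w′))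
      ≈ₚ (termMul a (m ⊕ z′) (binom z₁ w₁) List.++ termMul a (m ⊕ w₁) (binom z′ w′))
  binom-telescope a m z₁ z′ w₁ w′ n = begin
    coeff ((a * 1# , m ⊕ (z₁ ⊕ z′)) List.∷ (a * - 1# , m ⊕ (w₁ ⊕ w′)) List.∷ List.[]) n
      ≡⟨ cong₂ (λ u v → coeff ((a * 1# , u) List.∷ (a * - 1# , v) List.∷ List.[]) n) shuffle-z (sym (⊕-assoc m w₁ w′)) ⟩
    coeff ((a * 1# , (m ⊕ z′) ⊕ z₁) List.∷ last) n
      ≈⟨ coeff-∷-cong (a * 1# , (m ⊕ z′) ⊕ z₁) last _ n
           (≈-sym (coeff-cancel (a * - 1#) (a * 1#) middle last n (≈-trans (+-comm _ _) (opposite a)))) ⟩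
    coeff ((a * 1# , (m ⊕ z′) ⊕ z₁) List.∷ (a * - 1# , middle) List.∷ (a * 1# , middle) List.∷ last) n
      ≡⟨ cong (λ u → coeff ((a * 1# , (m ⊕ z′) ⊕ z₁) List.∷ (a * - 1# , u) List.∷ (a * 1# , middle) List.∷ last) n)
              (sym shuffle-w₁) ⟩
    coeff ((a * 1# , (m ⊕ z′) ⊕ z₁) List.∷ (a * - 1# , (m ⊕ z′) ⊕ w₁) List.∷ (a * 1# , middle) List.∷ last) n ∎
    where
    middle : Vec ℕ k
    middle = (m ⊕ w₁) ⊕ z′
    last : Polynomial
    last = (a * - 1# , (m ⊕ w₁) ⊕ w′) List.∷ List.[]
    shuffle-z : m ⊕ (z₁ ⊕ z′) ≡ (m ⊕ z′) ⊕ z₁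
    shuffle-z = trans (cong (m ⊕_) (⊕-comm z₁ z′)) (sym (⊕-assoc m z′ z₁))
    shuffle-w₁ : (m ⊕ z′) ⊕ w₁ ≡ middle
    shuffle-w₁ = trans (⊕-assoc m z′ w₁) (trans (cong (m ⊕_) (⊕-comm z′ w₁)) (sym (⊕-assoc m w₁ z′)))

  term : Carrier × Vec ℕ k × Polynomial → Polynomial
  term (a , m , g) = termMul a m g

  combination : List (Carrier × Vec ℕ k × Polynomial) → Polynomial
  combination = concatMap term

  ideal-resp : ∀ {G} p q → p ≈ₚ q → InIdeal G q → InIdeal G p
  ideal-resp _ _ p≈q (L , gens , q≈L) = L , gens , λ n → ≈-trans (p≈q n) (q≈L n)

  ideal-[] : ∀ {G} → InIdeal G List.[]
  ideal-[] = List.[] , All.[] , λ _ → ≈-refl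

  ideal-++ : ∀ {G} p q → InIdeal G p → InIdeal G q → InIdeal G (p List.++ q)
  ideal-++ p q (L , gens , p≈L) (L′ , gens′ , q≈L′) = L List.++ L′ , AllP.++⁺ gens gens′ , λ n → begin
    coeff (p List.++ q) n                                ≈⟨ coeff-++ p q n ⟩
    coeff p n + coeff q n                                ≈⟨ +-cong (p≈L n) (q≈L′ n) ⟩
    coeff (combination L) n + coeff (combination L′) n   ≈⟨ ≈-sym (coeff-++ (combination L) _ n) ⟩
    coeff (combination L List.++ combination L′) n       ≡⟨ cong (λ r → coeff r n) (sym (ListP.concatMap-++ term L L′)) ⟩
    coeff (combination (L List.++ L′)) n                 ∎

  ideal-generator : ∀ {G g} a m → G g → InIdeal G (termMul a m g)
  ideal-generator {g = g} a m g∈G =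
    (a , m , g) List.∷ List.[] , g∈G All.∷ All.[] ,
    λ n → reflexive (cong (λ r → coeff r n) (sym (ListP.++-identityʳ (termMul a m g))))

  ideal-mono : ∀ {G G′} → (∀ g → G g → G′ g) → ∀ p → InIdeal G p → InIdeal G′ p
  ideal-mono G⊆G′ p (L , gens , p≈L) = L , All.map (λ {(a , m , g)} → G⊆G′ g) gens , p≈L

  ideal-⊆ : ∀ {G G′} → (∀ g → G′ g → ∀ a m → InIdeal G (termMul a m g)) →
            ∀ p → InIdeal G′ p → InIdeal G p
  ideal-⊆ {G} {G′} multiples-in-G p (L , gens , p≈L) = ideal-resp p (combination L) p≈L (combination-in L gens)
    where
    combination-in : ∀ L → All (λ { (a , m , g) → G′ g }) L → InIdeal G (combination L)
    combination-in List.[]                  All.[]           = ideal-[]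
    combination-in ((a , m , g) List.∷ L) (g∈G′ All.∷ gens) =
      ideal-++ (termMul a m g) (combination L) (multiples-in-G g g∈G′ a m) (combination-in L gens)

module HilbertBasisGenerators {c ℓ} (K : CommutativeRing c ℓ) {d k : ℕ} (α : Vec (Vec ℕ d) k) (j : ℕ) where
  open CommutativeRing K using (-_)
  open Poly K k
  open BinomialIdeals K k

  Ker : Vec ℕ (k ℕ.+ (k ℕ.+ 1)) → Set
  Ker = Kernel (matA α)

  Ker? : ∀ x → Dec (Ker x)
  Ker? x = VecP.≡-dec ℤP._≟_ (mulVec (matA α) x) _

  open AtomicDecomposition Ker Ker? using (decompose)

  hilbert⊆factorization : ∀ g → HilbertGens K α j g → FactorizationGens K α j g
  hilbert⊆factorization g (z , w , i , (inKer , _) , i≤j , g≡) with kernel⇒ α {z} {w} {i} inKer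
  ... | same-element , same-length =
    lincomb α z , z , w , (z , refl) , refl , sym same-element , subst (_≤ j) (sym distance) i≤j , g≡
    where
    distance : ℕ.∣ len w - len z ∣ ≡ i
    distance = trans (cong (λ t → ℕ.∣ len w - t ∣) same-length) (ℕP.∣m-m+n∣≡n (len w) i)

  atoms-in-ideal : ∀ xs → All (IsAtom Ker) xs → ∀ {z w i} → triple z w i ≡ sumᵥ xs → i ≤ j →
                   ∀ a m → InIdeal (HilbertGens K α j) (termMul a m (binom z w))
  atoms-in-ideal List.[] All.[] {z} {w} {i} z,w,i≡0 _ a m =
    subst (λ v → InIdeal (HilbertGens K α j) (termMul a m (binom z v))) z≡w
      (ideal-resp (termMul a m (binom z z)) List.[] (binom-diagonal a m z) ideal-[])
    where
    zero-triple : z ≡ 0ⁿ × w ≡ 0ⁿ × i ≡ 0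
    zero-triple = triple-injective z 0ⁿ w 0ⁿ (trans z,w,i≡0 (triple-0 {k}))
    z≡w : z ≡ w
    z≡w = trans (proj₁ zero-triple) (sym (proj₁ (proj₂ zero-triple)))
  atoms-in-ideal (x List.∷ xs) (x-atom All.∷ atoms) {z} {w} x+xs≡ i≤j a m
    with triple-surjective {k} x | triple-surjective {k} (sumᵥ xs)
  ... | z₁ , w₁ , i₁ , refl | z′ , w′ , i′ , xs≡
    with triple-injective z (z₁ ⊕ z′) w (w₁ ⊕ w′)
           (trans x+xs≡ (trans (cong (triple z₁ w₁ i₁ ⊕_) xs≡) (triple-⊕ z₁ z′ w₁ w′ i₁ i′)))
  ... | refl , refl , refl =
    ideal-resp (termMul a m (binom (z₁ ⊕ z′) (w₁ ⊕ w′))) (first List.++ rest)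
      (binom-telescope a m z₁ z′ w₁ w′)
      (ideal-++ first rest first-in-ideal rest-in-ideal)
    where
    first rest : Polynomial
    first = termMul a (m ⊕ z′) (binom z₁ w₁)
    rest  = termMul a (m ⊕ w₁) (binom z′ w′)
    first-in-ideal : InIdeal (HilbertGens K α j) first
    first-in-ideal =
      ideal-generator a (m ⊕ z′) (z₁ , w₁ , i₁ , x-atom , ℕP.≤-trans (ℕP.m≤m+n i₁ i′) i≤j , refl)
    rest-in-ideal : InIdeal (HilbertGens K α j) rest
    rest-in-ideal = atoms-in-ideal xs atoms (sym xs≡) (ℕP.≤-trans (ℕP.m≤n+m i′ i₁) i≤j) a (m ⊕ w₁)

  oriented-in-ideal : ∀ {z w i} → lincomb α z ≡ lincomb α w → len z ≡ len w ℕ.+ i → i ≤ j →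
                      ∀ a m → InIdeal (HilbertGens K α j) (termMul a m (binom z w))
  oriented-in-ideal {z} {w} {i} same-element same-length i≤j a m =
    let (xs , atoms , z,w,i≡) = decompose (triple z w i) (kernel⇐ α same-element same-length)
    in atoms-in-ideal xs atoms z,w,i≡ i≤j a m

  -- Every term multiple of a generator of I_j lies in the ideal of
  -- Hilbert-basis binomials; if |z| < |w| use y^z - y^w = -(y^w - y^z).
  factorization-in-ideal : ∀ g → FactorizationGens K α j g → ∀ a m → InIdeal (HilbertGens K α j) (termMul a m g)
  factorization-in-ideal g (_ , z , w , _ , z∈Z , w∈Z , bound , refl) a m with ℕP.≤-total (len w) (len z)
  ... | inj₁ w≤z =
    oriented-in-ideal (trans z∈Z (sym w∈Z)) (sym (ℕP.m+[n∸m]≡n w≤z))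
      (subst (_≤ j) (ℕP.m≤n⇒∣m-n∣≡n∸m w≤z) bound) a m
  ... | inj₂ z≤w =
    ideal-resp (termMul a m (binom z w)) (termMul (- a) m (binom w z)) (binom-antisym a m z w)
      (oriented-in-ideal (trans w∈Z (sym z∈Z)) (sym (ℕP.m+[n∸m]≡n z≤w))
        (subst (_≤ j) (ℕP.m≤n⇒∣n-m∣≡n∸m z≤w) bound) (- a) m)

lemma3p7 : ∀ {c ℓ} (K : CommutativeRing c ℓ) → IsField K
         → (d k : ℕ) (α : Vec (Vec ℕ d) k) → MinimalGenerators α
         → (j : ℕ)
         → Poly.SameIdeal K k (HilbertGens K α j) (FactorizationGens K α j)
lemma3p7 K _ d k α _ j p =
    ideal-mono hilbert⊆factorization p
  , ideal-⊆ factorization-in-ideal p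
  where
  open BinomialIdeals K k using (ideal-mono; ideal-⊆)
  open HilbertBasisGenerators K α j using (hilbert⊆factorization; factorization-in-ideal)
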